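{- Let $G$ be a group, $X$ a set with a transitive action of $G$, and $A$ an abelian group. Let $G$ act on $A^X$ (the group of all functions $X\to A$) by $(g\cdot f)(y)=f(g^{ -1}y)$, and put $H=A^X\rtimes G$, with projection $\pi:H\to G$ (so $\ker\pi=A^X$). Let $\delta:A\to A^X$ be the diagonal map $\delta(a)(y)=a$; its image is central in $H$. Let $\mathcal{C}$ be the set of subgroups $C\subset H$ with $\pi(C)=G$ and $C\cap\ker\pi=1$, and $\mathcal{G}$ the set of subgroups $\widetilde G\subset H$ with $\pi(\widetilde G)=G$ and $\widetilde G\cap\ker\pi=\delta(A)$; $H$ acts on both sets by conjugation. For $\chi\in\mathrm{Hom}(G,A)$ put $G^{\chi}=\{\delta(\chi(g))\,g:\ g\in G\}\in\mathcal{C}$. Let ${\rm c}_2:\mathcal{G}\to {\rm H}^2(G,A)$ send $\widetilde G$ to the class of the central extension $1\to A\xrightarrow{\delta}\widetilde G\xrightarrow{\pi}G\to1$ ($A$ a trivial $G$-module); it is constant on $H$-conjugacy classes. Fix $x\in X$ with stabilizer $G_x$, and let ${\rm r}_m:{\rm H}^m(G,A)\to{\rm H}^m(G_x,A)$ be restriction. Then: (i) For $\chi,\chi'\in\mathrm{Hom}(G,A)$, the subgroups $G^{\chi}$ and $G^{\chi'}$ are conjugate in $H$ if and only if $\chi$ and $\chi'$ coincide on $G_x$. (ii) If ${\rm r}_1$ is surjective, then every $C\in\mathcal{C}$ is conjugate in $H$ to $G^{\chi}$ for some $\chi\in\mathrm{Hom}(G,A)$. (iii) If ${\rm r}_1$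 is surjective, then the induced map ${\rm c}_2:H\backslash\mathcal{G}\to{\rm H}^2(G,A)$ is injective, and its image is $\ker{\rm r}_2$, the subgroup of classes of extensions which split over $G_x$.
   Context: All group actions are on the left. Cohomology groups are those of the trivial $G$-module (resp. $G_x$-module) $A$. -}

module Defs where

-- Group-theoretic setup for Proposition 2.3.
-- Groups are sets with propositional equality (stdlib IsGroup over _≡_);
-- the group A^X of all functions X → A is modelled with pointwise equality
-- (no function extensionality is available).

open import Data.Product using (Σ; ∃; ∃-syntax; _×_; _,_; proj₁; proj₂)
open import Relation.Binary.PropositionalEquality using (_≡_)
open import Algebra.Core using (Op₁; Op₂)
open import Algebra.Structures using (IsGroup; IsAbelianGroup)

record ≡Group : Set₁ where
  infixl 7 _∙_
  field
    Carrier : Set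
    _∙_     : Op₂ Carrier
    ε       : Carrier
    _⁻¹     : Op₁ Carrier
    isGroup : IsGroup _≡_ _∙_ ε _⁻¹

record ≡AbGroup : Set₁ where
  infixl 6 _+_
  field
    Carrier        : Set
    _+_            : Op₂ Carrier
    0#             : Carrier
    -_             : Op₁ Carrier
    isAbelianGroup : IsAbelianGroup _≡_ _+_ 0# -_

record Action (G : ≡Group) (X : Set) : Set where
  open ≡Group G
  field
    act   : Carrier → X → X
    act-ε : ∀ y → act ε y ≡ y
    act-∙ : ∀ g h y → act (g ∙ h) y ≡ act g (act h y)

Transitive : {G : ≡Group} {X : Set} → Action G X → Set
Transitive {G} {X} α = ∀ (y z : X) → ∃[ g ] Action.act α g y ≡ z

module Setup (G : ≡Group) (A : ≡AbGroup) (X : Set) (α : Action G X) where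
  open ≡Group G renaming (Carrier to |G|)
  open ≡AbGroup A renaming (Carrier to |A|)
  open Action α

  _-_ : |A| → |A| → |A|
  a - b = a + (- b)

  -- H = A^X ⋊ G, elements (f , g) standing for f·g
  H : Set
  H = (X → |A|) × |G|

  infix 4 _≈H_
  _≈H_ : H → H → Set
  (f , g) ≈H (f' , g') = (∀ y → f y ≡ f' y) × (g ≡ g')

  gact : |G| → (X → |A|) → (X → |A|)
  gact g f y = f (act (g ⁻¹) y)

  infixl 7 _·_
  _·_ : H → H → H
  (f , g) · (f' , g') = (λ y → f y + gact g f' y) , (g ∙ g')

  1H : H
  1H = (λ _ → 0#) , ε

  -- (f , g)⁻¹ = (g⁻¹·(-f) , g⁻¹)
  invH : H → H
  invH (f , g) = (λ y → - f (act g y)) , (g ⁻¹)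

  π : H → |G|
  π = proj₂

  δ : |A| → H
  δ a = (λ _ → a) , ε

  record Subgroup : Set₁ where
    field
      S        : H → Set
      resp     : ∀ {h k} → h ≈H k → S h → S k
      has-1    : S 1H
      closed-· : ∀ {h k} → S h → S k → S (h · k)
      closed-⁻¹ : ∀ {h} → S h → S (invH h)

  Conjugate : (H → Set) → (H → Set) → Set
  Conjugate S T = ∃[ k ] (∀ h → (S h → T (k · h · invH k)) × (T (k · h · invH k) → S h))

  Surjπ : (H → Set) → Set
  Surjπ S = ∀ g → ∃[ h ] (S h × π h ≡ g)

  Inℭ : Subgroup → Set
  Inℭ C = Surjπ S × (∀ h → S h → π h ≡ ε → h ≈H 1H)
    where open Subgroup C

  In𝔊 : Subgroup → Set
  In𝔊 C = Surjπ S × (∀ h → S h → π h ≡ ε → ∃[ a ] h ≈H δ a) × (∀ a → S (δ a))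
    where open Subgroup C

  record Hom : Set where
    field
      χ   : |G| → |A|
      hom : ∀ g h → χ (g ∙ h) ≡ χ g + χ h

  Gχ : Hom → H → Set
  Gχ φ h = ∃[ g ] h ≈H ((λ _ → Hom.χ φ g) , g)

  Stab : X → |G| → Set
  Stab x g = act g x ≡ x

  -- H¹(K, A) = Hom(K, A) for a subgroup K ⊆ G (trivial coefficients)
  record HomOn (K : |G| → Set) : Set where
    field
      ψ   : (g : |G|) → K g → |A|
      hom : ∀ g h (p : K g) (q : K h) (r : K (g ∙ h)) → ψ (g ∙ h) r ≡ ψ g p + ψ h q

  Res1Surj : X → Set
  Res1Surj x = (φ : HomOn (Stab x)) → ∃[ χ ] (∀ g (p : Stab x g) → Hom.χ χ g ≡ HomOn.ψ φ g p)

  Cochain2 : Set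
  Cochain2 = |G| → |G| → |A|

  Cocycle : Cochain2 → Set
  Cocycle c = ∀ g h k → c h k - c (g ∙ h) k + c g (h ∙ k) - c g h ≡ 0#

  Cohomologous : Cochain2 → Cochain2 → Set
  Cohomologous c c' = Σ (|G| → |A|) λ b → (∀ g h → c g h - c' g h ≡ b h - b (g ∙ h) + b g)

  InKerRes2 : X → Cochain2 → Set
  InKerRes2 x c = Σ ((g : |G|) → Stab x g → |A|) λ b → (∀ g h (p : Stab x g) (q : Stab x h) (r : Stab x (g ∙ h))
                     → c g h ≡ b h q - b (g ∙ h) r + b g p)

  -- c is a cocycle representing the class c₂(G̃) of the central extension
  -- 1 → A →δ G̃ →π G → 1 : there is a set-theoretic section s of π in G̃
  -- with s(g) s(h) = δ(c(g,h)) s(gh).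
  Represents : Subgroup → Cochain2 → Set
  Represents C c = Σ (|G| → H) λ s → ((∀ g → Subgroup.S C (s g)) × (∀ g → π (s g) ≡ g)
                     × (∀ g h → s g · s h ≈H δ (c g h) · s (g ∙ h)))

{-# OPTIONS --safe #-}
-- Everything reduces to Shapiro's lemma for the coinduced module A^X. A subgroup of H in 𝒞
-- (resp. 𝒢) is the graph {(a + F g , g)} of a 1-cochain F : G → A^X with a = 0 (resp. a ∈ A),
-- and conjugating by (φ , 1) changes F by the coboundary of φ. Fix t(y) ∈ G with t(y)·x = y.
-- A 1-cocycle d of G in A^X with d(s)(x) = 0 for s ∈ G_x is the coboundary of y ↦ d(t y)(y);
-- so if r₁ is onto, every 1-cocycle is a homomorphism χ plus a coboundary. This gives (i), (ii),
-- and the injectivity in (iii) when applied to the difference of two sections. Conversely, if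
-- the restriction of a 2-cocycle c to G_x is a coboundary ∂b, then t and b give an explicit
-- F : G → A^X with ∂F = c, and the graph of F is the required extension.

module Submission where

open import Defs
open import Algebra.Bundles using (Group; AbelianGroup)
open import Algebra.Structures using (IsGroup; IsAbelianGroup)
import Algebra.Properties.AbelianGroup
import Algebra.Properties.Group
open import Data.Product using (∃; ∃-syntax; _×_; _,_; proj₁; proj₂)
open import Data.Unit using (⊤; tt)
open import Function.Bundles using (_⇔_; mk⇔)
open import Level using (0ℓ)
open import Relation.Binary.PropositionalEquality
  using (_≡_; refl; sym; trans; cong; cong₂; subst; module ≡-Reasoning)
open import Relation.Binary.PropositionalEquality.Properties using (dcong₂)
open import Relation.Unary using (_⊆_; _≐_)
open import Relation.Unary.Properties using (≐-sym; ≐-trans)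

module AbelianGroupSolver {c ℓ} (G : AbelianGroup c ℓ) where

  open import Data.Fin.Base using (Fin; zero; suc)
  open import Data.Nat.Base as ℕ using (ℕ; zero; suc; _∸_)
  open import Data.Product.Base using (_×_; _,_; swap)
  open import Data.Vec.Base using (Vec; []; _∷_; lookup; replicate; zipWith; map)
  open import Algebra.Properties.AbelianGroup G using (⁻¹-∙-comm; ⁻¹-anti-homo‿-; ε⁻¹≈ε)
  open import Algebra.Properties.CommutativeSemigroup (AbelianGroup.commutativeSemigroup G) using (interchange)
  open AbelianGroup G
    renaming (_∙_ to _+_; ε to 0#; _⁻¹ to -_; refl to ≈-refl; sym to ≈-sym; trans to ≈-trans)
  open import Algebra.Properties.Monoid.Mult monoid using (×-homo-+) renaming (_×_ to _·_)
  open import Relation.Binary.Reasoning.Setoid setoid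

  infixl 6 _:+_ _:-_
  infix  8 :-_

  data Expr (n : ℕ) : Set where
    var  : Fin n → Expr n
    :0   : Expr n
    _:+_ : Expr n → Expr n → Expr n
    :-_  : Expr n → Expr n

  _:-_ : ∀ {n} → Expr n → Expr n → Expr n
  e₁ :- e₂ = e₁ :+ :- e₂

  ⟦_⟧ : ∀ {n} → Expr n → Vec Carrier n → Carrier
  ⟦ var i    ⟧ ρ = lookup ρ i
  ⟦ :0       ⟧ ρ = 0#
  ⟦ e₁ :+ e₂ ⟧ ρ = ⟦ e₁ ⟧ ρ + ⟦ e₂ ⟧ ρ
  ⟦ :- e     ⟧ ρ = - ⟦ e ⟧ ρ

  -- An integer coefficient is a pair (p , q) standing for p - q, kept
  -- reduced (one side zero) so that equal coefficients are syntactically equal.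
  Coefficient : Set
  Coefficient = ℕ × ℕ

  reduce : Coefficient → Coefficient
  reduce (p , q) = (p ∸ q , q ∸ p)

  _⊛_ : Coefficient → Carrier → Carrier
  (p , q) ⊛ a = p · a - q · a

  Normal : ℕ → Set
  Normal = Vec Coefficient

  ⟦_⟧⇓ : ∀ {n} → Normal n → Vec Carrier n → Carrier
  ⟦ []    ⟧⇓ []      = 0#
  ⟦ k ∷ v ⟧⇓ (a ∷ ρ) = k ⊛ a + ⟦ v ⟧⇓ ρ

  empty : ∀ {n} → Normal n
  empty = replicate _ (0 , 0)

  singleton : ∀ {n} → Fin n → Normal n
  singleton zero    = (1 , 0) ∷ empty
  singleton (suc i) = (0 , 0) ∷ singleton i

  _⊞_ : ∀ {n} → Normal n → Normal n → Normal n
  _⊞_ = zipWith λ (p , q) (p′ , q′) → reduce (p ℕ.+ p′ , q ℕ.+ q′)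

  normalise : ∀ {n} → Expr n → Normal n
  normalise (var i)    = singleton i
  normalise :0         = empty
  normalise (e₁ :+ e₂) = normalise e₁ ⊞ normalise e₂
  normalise (:- e)     = map swap (normalise e)

  sub-interchange : ∀ x y x′ y′ → (x + x′) - (y + y′) ≈ (x - y) + (x′ - y′)
  sub-interchange x y x′ y′ = begin
    (x + x′) - (y + y′)       ≈⟨ ∙-congˡ (⁻¹-∙-comm y y′) ⟨
    (x + x′) + (- y + - y′)   ≈⟨ interchange x x′ (- y) (- y′) ⟩
    (x - y) + (x′ - y′)       ∎

  reduce-correct : ∀ k a → reduce k ⊛ a ≈ k ⊛ a
  reduce-correct (zero  , zero ) a = ≈-refl
  reduce-correct (zero  , suc q) a = ≈-refl
  reduce-correct (suc p , zero ) a = ≈-refl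
  reduce-correct (suc p , suc q) a = begin
    reduce (p , q) ⊛ a          ≈⟨ reduce-correct (p , q) a ⟩
    p · a - q · a               ≈⟨ identityˡ _ ⟨
    0# + (p · a - q · a)        ≈⟨ ∙-congʳ (inverseʳ a) ⟨
    (a - a) + (p · a - q · a)   ≈⟨ sub-interchange a a (p · a) (q · a) ⟨
    (a + p · a) - (a + q · a)   ∎

  empty-correct : ∀ {n} (ρ : Vec Carrier n) → ⟦ empty ⟧⇓ ρ ≈ 0#
  empty-correct []      = ≈-refl
  empty-correct (a ∷ ρ) = begin
    (0# - 0#) + ⟦ empty ⟧⇓ ρ   ≈⟨ ∙-cong (inverseʳ 0#) (empty-correct ρ) ⟩
    0# + 0#                    ≈⟨ identityˡ 0# ⟩
    0#                         ∎

  singleton-correct : ∀ {n} (i : Fin n) ρ → ⟦ singleton i ⟧⇓ ρ ≈ lookup ρ i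
  singleton-correct zero (a ∷ ρ) = begin
    ((a + 0#) - 0#) + ⟦ empty ⟧⇓ ρ   ≈⟨ ∙-cong (∙-cong (identityʳ a) ε⁻¹≈ε) (empty-correct ρ) ⟩
    (a + 0#) + 0#                    ≈⟨ identityʳ _ ⟩
    a + 0#                           ≈⟨ identityʳ a ⟩
    a                                ∎
  singleton-correct (suc i) (a ∷ ρ) = begin
    (0# - 0#) + ⟦ singleton i ⟧⇓ ρ   ≈⟨ ∙-cong (inverseʳ 0#) (singleton-correct i ρ) ⟩
    0# + lookup ρ i                  ≈⟨ identityˡ _ ⟩
    lookup ρ i                       ∎

  ⊞-correct : ∀ {n} (v w : Normal n) ρ → ⟦ v ⊞ w ⟧⇓ ρ ≈ ⟦ v ⟧⇓ ρ + ⟦ w ⟧⇓ ρ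
  ⊞-correct []             []               []      = ≈-sym (identityˡ 0#)
  ⊞-correct ((p , q) ∷ v) ((p′ , q′) ∷ w) (a ∷ ρ) = begin
    reduce (p ℕ.+ p′ , q ℕ.+ q′) ⊛ a + ⟦ v ⊞ w ⟧⇓ ρ
      ≈⟨ ∙-cong (reduce-correct (p ℕ.+ p′ , q ℕ.+ q′) a) (⊞-correct v w ρ) ⟩
    ((p ℕ.+ p′) · a - (q ℕ.+ q′) · a) + (⟦ v ⟧⇓ ρ + ⟦ w ⟧⇓ ρ)
      ≈⟨ ∙-congʳ (∙-cong (×-homo-+ a p p′) (⁻¹-cong (×-homo-+ a q q′))) ⟩
    ((p · a + p′ · a) - (q · a + q′ · a)) + (⟦ v ⟧⇓ ρ + ⟦ w ⟧⇓ ρ)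
      ≈⟨ ∙-congʳ (sub-interchange (p · a) (q · a) (p′ · a) (q′ · a)) ⟩
    ((p , q) ⊛ a + (p′ , q′) ⊛ a) + (⟦ v ⟧⇓ ρ + ⟦ w ⟧⇓ ρ)
      ≈⟨ interchange _ _ _ _ ⟩
    ((p , q) ⊛ a + ⟦ v ⟧⇓ ρ) + ((p′ , q′) ⊛ a + ⟦ w ⟧⇓ ρ) ∎

  negate-correct : ∀ {n} (v : Normal n) ρ → ⟦ map swap v ⟧⇓ ρ ≈ - ⟦ v ⟧⇓ ρ
  negate-correct []            []      = ≈-sym ε⁻¹≈ε
  negate-correct ((p , q) ∷ v) (a ∷ ρ) = begin
    (q , p) ⊛ a + ⟦ map swap v ⟧⇓ ρ   ≈⟨ ∙-cong (≈-sym (⁻¹-anti-homo‿- (p · a) (q · a))) (negate-correct v ρ) ⟩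
    - (p , q) ⊛ a + - ⟦ v ⟧⇓ ρ        ≈⟨ ⁻¹-∙-comm _ _ ⟩
    - ((p , q) ⊛ a + ⟦ v ⟧⇓ ρ)        ∎

  correct : ∀ {n} (e : Expr n) ρ → ⟦ normalise e ⟧⇓ ρ ≈ ⟦ e ⟧ ρ
  correct (var i)    ρ = singleton-correct i ρ
  correct :0         ρ = empty-correct ρ
  correct (e₁ :+ e₂) ρ = ≈-trans (⊞-correct (normalise e₁) (normalise e₂) ρ) (∙-cong (correct e₁ ρ) (correct e₂ ρ))
  correct (:- e)     ρ = ≈-trans (negate-correct (normalise e) ρ) (⁻¹-cong (correct e ρ))

  open import Relation.Binary.Reflection setoid var ⟦_⟧ (λ e → ⟦ normalise e ⟧⇓) correct public
    using (solve; _⊜_)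

≡Group⇒Group : ≡Group → Group 0ℓ 0ℓ
≡Group⇒Group G = record { isGroup = ≡Group.isGroup G }

≡AbGroup⇒AbelianGroup : ≡AbGroup → AbelianGroup 0ℓ 0ℓ
≡AbGroup⇒AbelianGroup A = record { isAbelianGroup = ≡AbGroup.isAbelianGroup A }

module SemidirectProduct (G : ≡Group) (A : ≡AbGroup) (X : Set) (α : Action G X) where
  open Setup G A X α
  open ≡Group G renaming (Carrier to |G|)
  open ≡AbGroup A renaming (Carrier to |A|)
  open Action α
  private
    module GP = Algebra.Properties.Group (≡Group⇒Group G)
    module GS = IsGroup isGroup
    module AP = Algebra.Properties.AbelianGroup (≡AbGroup⇒AbelianGroup A)
    module AS = IsAbelianGroup isAbelianGroup
  open AbelianGroupSolver (≡AbGroup⇒AbelianGroup A) using (solve; _⊜_; :0; _:+_; :-_; _:-_)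
  open ≡-Reasoning

  act-trivial : ∀ {k} → k ≡ ε → ∀ y → act k y ≡ y
  act-trivial refl = act-ε

  act-inverseˡ : ∀ g y → act (g ⁻¹) (act g y) ≡ y
  act-inverseˡ g y = trans (sym (act-∙ (g ⁻¹) g y)) (act-trivial (GS.inverseˡ g) y)

  act-inverseʳ : ∀ g y → act g (act (g ⁻¹) y) ≡ y
  act-inverseʳ g y = trans (sym (act-∙ g (g ⁻¹) y)) (act-trivial (GS.inverseʳ g) y)

  act-ε⁻¹ : ∀ y → act (ε ⁻¹) y ≡ y
  act-ε⁻¹ = act-trivial GP.ε⁻¹≈ε

  act-∙⁻¹ : ∀ g h y → act ((g ∙ h) ⁻¹) y ≡ act (h ⁻¹) (act (g ⁻¹) y)
  act-∙⁻¹ g h y = trans (cong (λ k → act k y) (GP.⁻¹-anti-homo-∙ g h)) (act-∙ (h ⁻¹) (g ⁻¹) y)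

  Stab-⁻¹ : ∀ {x g} → Stab x g → Stab x (g ⁻¹)
  Stab-⁻¹ {x} {g} gx≡x = trans (cong (act (g ⁻¹)) (sym gx≡x)) (act-inverseˡ g x)

  Hom-conjugation-invariant : (χ : Hom) → ∀ k g → Hom.χ χ ((k ∙ g) ∙ k ⁻¹) ≡ Hom.χ χ g
  Hom-conjugation-invariant χ k g = AP.∙-cancelʳ (χ′ k) _ _ (begin
    χ′ ((k ∙ g) ∙ k ⁻¹) + χ′ k   ≡⟨ hom ((k ∙ g) ∙ k ⁻¹) k ⟨
    χ′ (((k ∙ g) ∙ k ⁻¹) ∙ k)    ≡⟨ cong χ′ (trans (GS.assoc _ _ _) (trans (cong (k ∙ g ∙_) (GS.inverseˡ k)) (GS.identityʳ _))) ⟩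
    χ′ (k ∙ g)                   ≡⟨ trans (hom k g) (AS.comm _ _) ⟩
    χ′ g + χ′ k                  ∎)
    where open Hom χ renaming (χ to χ′)

  ≈H-sym : ∀ {h k} → h ≈H k → k ≈H h
  ≈H-sym (f≡f′ , g≡g′) = (λ y → sym (f≡f′ y)) , sym g≡g′

  conjugate-by-kernel : ∀ (φ f : X → |A|) g →
    (φ , ε) · (f , g) · invH (φ , ε) ≈H ((λ y → (φ y + f y) - φ (act (g ⁻¹) y)) , g)
  conjugate-by-kernel φ f g =
      (λ y → cong₂ (λ z w → (φ y + f z) - φ w) (act-ε⁻¹ y)
                   (trans (act-ε _) (cong (λ k → act (k ⁻¹) y) (GS.identityˡ g))))
    , trans (cong₂ _∙_ (GS.identityˡ g) GP.ε⁻¹≈ε) (GS.identityʳ g)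

  Conjugate-resp : ∀ {S S′ T T′ : H → Set} → S ≐ S′ → T ≐ T′ → Conjugate S T → Conjugate S′ T′
  Conjugate-resp (S⊆S′ , S′⊆S) (T⊆T′ , T′⊆T) (k , conj) =
    k , λ h → (λ s → T⊆T′ (proj₁ (conj h) (S′⊆S s))) , (λ t → S⊆S′ (proj₂ (conj h) (T′⊆T t)))

  Graph : (|A| → Set) → (|G| → X → |A|) → H → Set
  Graph K F (f , g) = ∃[ a ] K a × (∀ y → f y ≡ a + F g y)

  Graph-resp : ∀ {K F h h′} → h ≈H h′ → Graph K F h → Graph K F h′
  Graph-resp (f≡f′ , refl) (a , Ka , f≡) = a , Ka , λ y → trans (sym (f≡f′ y)) (f≡ y)

  translate-injective : ∀ {p q z w} → (p + z) - q ≡ (p + w) - q → z ≡ w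
  translate-injective {p} {q} e = AP.∙-cancelˡ p _ _ (AP.∙-cancelʳ (- q) _ _ e)

  graph-conjugate : ∀ {K F F′} (φ : X → |A|) →
    (∀ g y → F′ g y ≡ (φ y + F g y) - φ (act (g ⁻¹) y)) → Conjugate (Graph K F) (Graph K F′)
  graph-conjugate {K} {F} {F′} φ F′≡ = (φ , ε) , λ (f , g) → to f g , from f g
    where
      shift : ∀ a g y → a + F′ g y ≡ (φ y + (a + F g y)) - φ (act (g ⁻¹) y)
      shift a g y = begin
        a + F′ g y                                      ≡⟨ cong (a +_) (F′≡ g y) ⟩
        a + ((φ y + F g y) - φ (act (g ⁻¹) y))          ≡⟨ solve 4 (λ a φy Fgy φu → a :+ ((φy :+ Fgy) :- φu) ⊜ (φy :+ (a :+ Fgy)) :- φu) refl a (φ y) (F g y) _ ⟩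
        (φ y + (a + F g y)) - φ (act (g ⁻¹) y)          ∎
      to : ∀ f g → Graph K F (f , g) → Graph K F′ ((φ , ε) · (f , g) · invH (φ , ε))
      to f g (a , Ka , f≡) = Graph-resp {K} {F′} (≈H-sym (conjugate-by-kernel φ f g))
        (a , Ka , λ y → trans (cong (λ z → (φ y + z) - φ (act (g ⁻¹) y)) (f≡ y)) (sym (shift a g y)))
      from : ∀ f g → Graph K F′ ((φ , ε) · (f , g) · invH (φ , ε)) → Graph K F (f , g)
      from f g t with Graph-resp {K} {F′} (conjugate-by-kernel φ f g) t
      ... | a , Ka , f≡ = a , Ka , λ y → translate-injective (trans (f≡ y) (shift a g y))

  graph-shift : ∀ (e : |G| → |A|) F → Graph (λ _ → ⊤) (λ g y → e g + F g y) ≐ Graph (λ _ → ⊤) F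
  graph-shift e F =
      (λ { {_ , g} (a , _ , f≡) → a + e g , tt , λ y → trans (f≡ y) (sym (AS.assoc _ _ _)) })
    , (λ { {_ , g} (a , _ , f≡) → a - e g , tt , λ y → trans (f≡ y)
             (solve 3 (λ a eg Fgy → a :+ Fgy ⊜ (a :- eg) :+ (eg :+ Fgy)) refl a (e g) (F _ y)) })

  Gχ≐Graph : ∀ χ → Gχ χ ≐ Graph (_≡ 0#) (λ g _ → Hom.χ χ g)
  Gχ≐Graph χ =
      (λ { {f , g} (.g , f≡ , refl) → 0# , refl , λ y → trans (f≡ y) (sym (AS.identityˡ _)) })
    , (λ { {f , g} (_ , refl , f≡) → g , (λ y → trans (f≡ y) (AS.identityˡ _)) , refl })

  KernelIs : (|A| → Set) → Subgroup → Set
  KernelIs K C = (∀ h → S h → π h ≡ ε → ∃[ a ] K a × h ≈H δ a) × (∀ a → K a → S (δ a))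
    where open Subgroup C

  Inℭ⇒KernelIs : ∀ {C} → Inℭ C → KernelIs (_≡ 0#) C
  Inℭ⇒KernelIs {C} (_ , trivial) = (λ h Sh πh≡ε → 0# , refl , trivial h Sh πh≡ε) , λ { _ refl → has-1 }
    where open Subgroup C

  In𝔊⇒KernelIs : ∀ {C} → In𝔊 C → KernelIs (λ _ → ⊤) C
  In𝔊⇒KernelIs (_ , kernel , δ∈) =
    (λ h Sh πh≡ε → let (a , h≈δa) = kernel h Sh πh≡ε in a , tt , h≈δa) , λ a _ → δ∈ a

  Section : Subgroup → (|G| → X → |A|) → Set
  Section C F = ∀ g → Subgroup.S C (F g , g)

  Surjπ⇒Section : ∀ {C} → Surjπ (Subgroup.S C) → ∃[ F ] Section C F
  Surjπ⇒Section {C} surj =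
    (λ g → proj₁ (proj₁ (surj g))) , λ g → resp ((λ _ → refl) , proj₂ (proj₂ (surj g))) (proj₁ (proj₂ (surj g)))
    where open Subgroup C

  graph-of-section : ∀ {K C F} → KernelIs K C → Section C F → Subgroup.S C ≐ Graph K F
  graph-of-section {K} {C} {F} (kernel , δ∈) sec = S⊆Graph , Graph⊆S
    where
      open Subgroup C
      S⊆Graph : S ⊆ Graph K F
      S⊆Graph {f , g} Sh with kernel _ (closed-· Sh (closed-⁻¹ (sec g))) (GS.inverseʳ g)
      ... | a , Ka , f-F≡a , _ = a , Ka , λ y → begin
        f y                                               ≡⟨ solve 2 (λ fy Fgy → fy ⊜ (fy :- Fgy) :+ Fgy) refl (f y) (F g y) ⟩
        (f y - F g y) + F g y                             ≡⟨ cong (λ z → (f y - F g z) + F g y) (act-inverseʳ g y) ⟨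
        (f y - F g (act g (act (g ⁻¹) y))) + F g y        ≡⟨ cong (_+ F g y) (f-F≡a y) ⟩
        a + F g y                                         ∎
      Graph⊆S : Graph K F ⊆ S
      Graph⊆S {f , g} (a , Ka , f≡) =
        resp ((λ y → trans (cong (λ z → a + F g z) (act-ε⁻¹ y)) (sym (f≡ y))) , GS.identityˡ g)
             (closed-· (δ∈ a Ka) (sec g))

  section-product : ∀ {K C F} → KernelIs K C → Section C F →
    ∀ g h → ∃[ a ] K a × (∀ y → F g y + F h (act (g ⁻¹) y) ≡ a + F (g ∙ h) y)
  section-product {K} {C} {F} kernel sec g h =
    proj₁ (graph-of-section {K} {C} {F} kernel sec) (Subgroup.closed-· C (sec g) (sec h))

  IsCrossedHom : (|G| → X → |A|) → Set
  IsCrossedHom d = ∀ g h y → d (g ∙ h) y ≡ d g y + d h (act (g ⁻¹) y)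

  Hom⇒IsCrossedHom : (χ : Hom) → IsCrossedHom (λ g _ → Hom.χ χ g)
  Hom⇒IsCrossedHom χ g h _ = Hom.hom χ g h

  IsCrossedHom-sub : ∀ {d e} → IsCrossedHom d → IsCrossedHom e → IsCrossedHom (λ g y → d g y - e g y)
  IsCrossedHom-sub {d} {e} d-cross e-cross g h y = begin
    d (g ∙ h) y - e (g ∙ h) y                        ≡⟨ cong₂ _-_ (d-cross g h y) (e-cross g h y) ⟩
    (d g y + d h u) - (e g y + e h u)                ≡⟨ solve 4 (λ dg dh eg eh → (dg :+ dh) :- (eg :+ eh) ⊜ (dg :- eg) :+ (dh :- eh)) refl _ _ _ _ ⟩
    (d g y - e g y) + (d h u - e h u)                ∎
    where u = act (g ⁻¹) y

  Inℭ-Section⇒IsCrossedHom : ∀ {C F} → Inℭ C → Section C F → IsCrossedHom F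
  Inℭ-Section⇒IsCrossedHom {C} {F} inℭ sec g h y with section-product {C = C} {F} (Inℭ⇒KernelIs {C} inℭ) sec g h
  ... | _ , refl , product≡ = sym (trans (product≡ y) (AS.identityˡ _))

  -- the 2-cochain δ ∘ c of G in A^X is the coboundary of F
  Trivialises : (|G| → X → |A|) → Cochain2 → Set
  Trivialises F c = ∀ g h y → F g y + F h (act (g ⁻¹) y) ≡ c g h + F (g ∙ h) y

  Trivialises-ε : ∀ {F c} → Trivialises F c → ∀ {g} → g ≡ ε → ∀ y → F g y ≡ c ε ε
  Trivialises-ε {F} {c} triv refl y = AP.∙-cancelʳ (F ε y) _ _ (begin
    F ε y + F ε y                    ≡⟨ cong (λ z → F ε y + F ε z) (act-ε⁻¹ y) ⟨
    F ε y + F ε (act (ε ⁻¹) y)       ≡⟨ triv ε ε y ⟩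
    c ε ε + F (ε ∙ ε) y              ≡⟨ cong (λ k → c ε ε + F k y) (GS.identityˡ ε) ⟩
    c ε ε + F ε y                    ∎)

  Trivialises-∙ : ∀ {F c} → Trivialises F c → ∀ g h y → F (g ∙ h) y ≡ (F g y + F h (act (g ⁻¹) y)) - c g h
  Trivialises-∙ {F} {c} triv g h y = begin
    F (g ∙ h) y                             ≡⟨ solve 2 (λ cgh Fgh → Fgh ⊜ (cgh :+ Fgh) :- cgh) refl (c g h) _ ⟩
    (c g h + F (g ∙ h) y) - c g h           ≡⟨ cong (_- c g h) (triv g h y) ⟨
    (F g y + F h (act (g ⁻¹) y)) - c g h    ∎

  Represents⇒Section : ∀ C c → Represents C c → ∃[ F ] Section C F × Trivialises F c
  Represents⇒Section C c (s , s∈ , πs , rel) =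
    F , (λ g → Subgroup.resp C ((λ _ → refl) , πs g) (s∈ g)) , λ g h y → begin
      F g y + F h (act (g ⁻¹) y)           ≡⟨ cong (λ k → F g y + F h (act (k ⁻¹) y)) (πs g) ⟨
      F g y + F h (act (π (s g) ⁻¹) y)     ≡⟨ proj₁ (rel g h) y ⟩
      c g h + F (g ∙ h) (act (ε ⁻¹) y)     ≡⟨ cong (λ z → c g h + F (g ∙ h) z) (act-ε⁻¹ y) ⟩
      c g h + F (g ∙ h) y                  ∎
    where
      F : |G| → X → |A|
      F g = proj₁ (s g)

  In𝔊⇒Represents : ∀ {C} → In𝔊 C → ∃[ c ] Represents C c
  In𝔊⇒Represents {C} in𝔊@(surj , _) with Surjπ⇒Section {C} surj
  ... | F , sec = c , (λ g → F g , g) , sec , (λ _ → refl) , λ g h →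
          (λ y → trans (proj₂ (proj₂ (product g h)) y) (cong (λ z → c g h + F (g ∙ h) z) (sym (act-ε⁻¹ y))))
        , sym (GS.identityˡ (g ∙ h))
    where
      product = section-product {C = C} {F} (In𝔊⇒KernelIs {C} in𝔊) sec
      c : Cochain2
      c g h = proj₁ (product g h)

  Trivialises⇒InKerRes2 : ∀ {F c} x → Trivialises F c → InKerRes2 x c
  Trivialises⇒InKerRes2 {F} {c} x triv = (λ g _ → F g x) , λ g h gx≡x _ _ → begin
    c g h                                ≡⟨ solve 2 (λ cgh Fghx → cgh ⊜ (cgh :+ Fghx) :- Fghx) refl _ _ ⟩
    (c g h + F (g ∙ h) x) - F (g ∙ h) x  ≡⟨ cong (_- F (g ∙ h) x) (triv g h x) ⟨
    (F g x + F h (act (g ⁻¹) x)) - F (g ∙ h) x ≡⟨ cong (λ z → (F g x + F h z) - F (g ∙ h) x) (Stab-⁻¹ gx≡x) ⟩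
    (F g x + F h x) - F (g ∙ h) x        ≡⟨ solve 3 (λ Fgx Fhx Fghx → (Fgx :+ Fhx) :- Fghx ⊜ (Fhx :- Fghx) :+ Fgx) refl _ _ _ ⟩
    (F h x - F (g ∙ h) x) + F g x        ∎

  module GraphSubgroup {F c} (triv : Trivialises F c) where

    subgroup : Subgroup
    subgroup = record
      { S         = Graph (λ _ → ⊤) F
      ; resp      = Graph-resp {λ _ → ⊤} {F}
      ; has-1     = - c ε ε , tt , λ y → sym (trans (cong (- c ε ε +_) (Trivialises-ε triv refl y)) (AS.inverseˡ _))
      ; closed-·  = closed-·
      ; closed-⁻¹ = closed-⁻¹
      }
      where
        closed-· : ∀ {h k} → Graph (λ _ → ⊤) F h → Graph (λ _ → ⊤) F k → Graph (λ _ → ⊤) F (h · k)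
        closed-· {f , g} {f′ , g′} (a , _ , f≡) (a′ , _ , f′≡) = (a + a′) + c g g′ , tt , λ y → begin
          f y + f′ (act (g ⁻¹) y)                       ≡⟨ cong₂ _+_ (f≡ y) (f′≡ _) ⟩
          (a + F g y) + (a′ + F g′ (act (g ⁻¹) y))      ≡⟨ solve 4 (λ a a′ Fg Fg′ → (a :+ Fg) :+ (a′ :+ Fg′) ⊜ (a :+ a′) :+ (Fg :+ Fg′)) refl _ _ _ _ ⟩
          (a + a′) + (F g y + F g′ (act (g ⁻¹) y))      ≡⟨ cong ((a + a′) +_) (triv g g′ y) ⟩
          (a + a′) + (c g g′ + F (g ∙ g′) y)            ≡⟨ AS.assoc _ _ _ ⟨
          ((a + a′) + c g g′) + F (g ∙ g′) y            ∎

        F-⁻¹ : ∀ g y → (c g (g ⁻¹) + c ε ε) - F g (act g y) ≡ F (g ⁻¹) y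
        F-⁻¹ g y = begin
          (c g (g ⁻¹) + c ε ε) - F g (act g y)
            ≡⟨ cong (λ z → (c g (g ⁻¹) + z) - F g (act g y)) (Trivialises-ε triv (GS.inverseʳ g) (act g y)) ⟨
          (c g (g ⁻¹) + F (g ∙ g ⁻¹) (act g y)) - F g (act g y)
            ≡⟨ cong (_- F g (act g y)) (triv g (g ⁻¹) (act g y)) ⟨
          (F g (act g y) + F (g ⁻¹) (act (g ⁻¹) (act g y))) - F g (act g y)
            ≡⟨ cong (λ z → (F g (act g y) + F (g ⁻¹) z) - F g (act g y)) (act-inverseˡ g y) ⟩
          (F g (act g y) + F (g ⁻¹) y) - F g (act g y)
            ≡⟨ solve 2 (λ Fg Fg⁻¹ → (Fg :+ Fg⁻¹) :- Fg ⊜ Fg⁻¹) refl _ _ ⟩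
          F (g ⁻¹) y ∎

        closed-⁻¹ : ∀ {h} → Graph (λ _ → ⊤) F h → Graph (λ _ → ⊤) F (invH h)
        closed-⁻¹ {f , g} (a , _ , f≡) = ((- a) - c g (g ⁻¹)) - c ε ε , tt , λ y → begin
          - f (act g y)                                  ≡⟨ cong -_ (f≡ (act g y)) ⟩
          - (a + F g (act g y))                          ≡⟨ solve 4 (λ a cg⁻¹ cεε Fg → :- (a :+ Fg) ⊜ (((:- a) :- cg⁻¹) :- cεε) :+ ((cg⁻¹ :+ cεε) :- Fg)) refl _ _ _ _ ⟩
          (((- a) - c g (g ⁻¹)) - c ε ε) + ((c g (g ⁻¹) + c ε ε) - F g (act g y))
                                                         ≡⟨ cong ((((- a) - c g (g ⁻¹)) - c ε ε) +_) (F-⁻¹ g y) ⟩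
          (((- a) - c g (g ⁻¹)) - c ε ε) + F (g ⁻¹) y    ∎

    subgroup-In𝔊 : In𝔊 subgroup
    subgroup-In𝔊 =
        (λ g → (F g , g) , (0# , tt , λ _ → sym (AS.identityˡ _)) , refl)
      , (λ { (f , g) (a , _ , f≡) g≡ε → a + c ε ε , (λ y → trans (f≡ y) (cong (a +_) (Trivialises-ε triv g≡ε y))) , g≡ε })
      , λ a → a - c ε ε , tt , λ y → begin
          a                          ≡⟨ solve 2 (λ a cεε → a ⊜ (a :- cεε) :+ cεε) refl a (c ε ε) ⟩
          (a - c ε ε) + c ε ε        ≡⟨ cong ((a - c ε ε) +_) (Trivialises-ε triv refl y) ⟨
          (a - c ε ε) + F ε y        ∎

    subgroup-Represents : Represents subgroup c
    subgroup-Represents =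
        (λ g → F g , g) , (λ g → 0# , tt , λ _ → sym (AS.identityˡ _)) , (λ _ → refl)
      , λ g h → (λ y → trans (triv g h y) (cong (λ z → c g h + F (g ∙ h) z) (sym (act-ε⁻¹ y))))
              , sym (GS.identityˡ (g ∙ h))

  Trivialises-cohomologous : ∀ {F₁ F₂ c₁ c₂} → Trivialises F₁ c₁ → Trivialises F₂ c₂ → (b : |G| → |A|) →
    (∀ g h → c₁ g h - c₂ g h ≡ (b h - b (g ∙ h)) + b g) → IsCrossedHom (λ g y → (F₁ g y - F₂ g y) - b g)
  Trivialises-cohomologous {F₁} {F₂} {c₁} {c₂} triv₁ triv₂ b coh g h y = begin
    (F₁ (g ∙ h) y - F₂ (g ∙ h) y) - b (g ∙ h)
      ≡⟨ cong₂ (λ z w → (z - w) - b (g ∙ h)) (Trivialises-∙ triv₁ g h y) (Trivialises-∙ triv₂ g h y) ⟩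
    (((F₁ g y + F₁ h u) - c₁ g h) - ((F₂ g y + F₂ h u) - c₂ g h)) - b (g ∙ h)
      ≡⟨ solve 9 (λ F₁g F₁h F₂g F₂h c₁ c₂ bg bh bgh →
             (((F₁g :+ F₁h) :- c₁) :- ((F₂g :+ F₂h) :- c₂)) :- bgh
           ⊜ (((F₁g :- F₂g) :- bg) :+ ((F₁h :- F₂h) :- bh)) :+ (((bh :- bgh) :+ bg) :- (c₁ :- c₂)))
           refl _ _ _ _ _ _ _ _ _ ⟩
    (D g y + D h u) + (((b h - b (g ∙ h)) + b g) - (c₁ g h - c₂ g h))
      ≡⟨ cong (λ z → (D g y + D h u) + (z - (c₁ g h - c₂ g h))) (coh g h) ⟨
    (D g y + D h u) + ((c₁ g h - c₂ g h) - (c₁ g h - c₂ g h))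
      ≡⟨ solve 2 (λ d e → d :+ (e :- e) ⊜ d) refl _ _ ⟩
    D g y + D h u ∎
    where
      u = act (g ⁻¹) y
      D : |G| → X → |A|
      D g y = (F₁ g y - F₂ g y) - b g

  Cohomologous-refl : ∀ c → Cohomologous c c
  Cohomologous-refl c = (λ _ → 0#) , λ g h → trans (AS.inverseʳ (c g h)) (solve 0 (:0 ⊜ (:0 :- :0) :+ :0) refl)

  Cocycle⇒identity : ∀ {c} → Cocycle c → ∀ g h k → c g h + c (g ∙ h) k ≡ c g (h ∙ k) + c h k
  Cocycle⇒identity {c} cocycle g h k = AP.x∙y⁻¹≈ε⇒x≈y _ _ (begin
    (c g h + c (g ∙ h) k) - (c g (h ∙ k) + c h k)
      ≡⟨ solve 4 (λ cgh cgh,k cg,hk chk → (cgh :+ cgh,k) :- (cg,hk :+ chk) ⊜ :- ((chk :- cgh,k) :+ (cg,hk :- cgh))) refl _ _ _ _ ⟩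
    - ((c h k - c (g ∙ h) k) + (c g (h ∙ k) - c g h))
      ≡⟨ cong -_ (cocycle g h k) ⟩
    - 0#
      ≡⟨ AP.ε⁻¹≈ε ⟩
    0# ∎)

  Cocycle-transfer : ∀ {c} → Cocycle c → ∀ {g h T U W σ₁ σ₂} → g ∙ U ≡ T ∙ σ₁ → h ∙ W ≡ U ∙ σ₂ →
    (c g U - c T σ₁) + (c h W - c U σ₂) ≡ (c g h - c σ₁ σ₂) + (c (g ∙ h) W - c T (σ₁ ∙ σ₂))
  Cocycle-transfer {c} cocycle {g} {h} {T} {U} {W} {σ₁} {σ₂} gU≡Tσ₁ hW≡Uσ₂ = AP.x∙y⁻¹≈ε⇒x≈y _ _ (begin
    ((c g U - c T σ₁) + (c h W - c U σ₂)) - ((c g h - c σ₁ σ₂) + (c (g ∙ h) W - c T (σ₁ ∙ σ₂)))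
      ≡⟨ solve 10 (λ cgU cTσ₁ chW cUσ₂ cgh cσ₁σ₂ cghW cTσ₁σ₂ cgUσ₂ cTσ₁,σ₂ →
             ((cgU :- cTσ₁) :+ (chW :- cUσ₂)) :- ((cgh :- cσ₁σ₂) :+ (cghW :- cTσ₁σ₂))
           ⊜ (((cgU :+ cTσ₁,σ₂) :- (cgUσ₂ :+ cUσ₂)) :- ((cgh :+ cghW) :- (cgUσ₂ :+ chW)))
               :- ((cTσ₁ :+ cTσ₁,σ₂) :- (cTσ₁σ₂ :+ cσ₁σ₂)))
           refl _ _ _ _ _ _ _ _ _ _ ⟩
    (((c g U + c (T ∙ σ₁) σ₂) - (c g (U ∙ σ₂) + c U σ₂)) - ((c g h + c (g ∙ h) W) - (c g (U ∙ σ₂) + c h W)))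
      - ((c T σ₁ + c (T ∙ σ₁) σ₂) - (c T (σ₁ ∙ σ₂) + c σ₁ σ₂))
      ≡⟨ cong₂ _-_ (cong₂ _-_ (AP.x≈y⇒x∙y⁻¹≈ε at-gUσ₂) (AP.x≈y⇒x∙y⁻¹≈ε at-ghW)) (AP.x≈y⇒x∙y⁻¹≈ε at-Tσ₁σ₂) ⟩
    (0# - 0#) - 0#
      ≡⟨ solve 0 ((:0 :- :0) :- :0 ⊜ :0) refl ⟩
    0# ∎)
    where
      at-ghW : c g h + c (g ∙ h) W ≡ c g (U ∙ σ₂) + c h W
      at-ghW = trans (Cocycle⇒identity cocycle g h W) (cong (λ k → c g k + c h W) hW≡Uσ₂)
      at-gUσ₂ : c g U + c (T ∙ σ₁) σ₂ ≡ c g (U ∙ σ₂) + c U σ₂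
      at-gUσ₂ = trans (cong (λ k → c g U + c k σ₂) (sym gU≡Tσ₁)) (Cocycle⇒identity cocycle g U σ₂)
      at-Tσ₁σ₂ : c T σ₁ + c (T ∙ σ₁) σ₂ ≡ c T (σ₁ ∙ σ₂) + c σ₁ σ₂
      at-Tσ₁σ₂ = Cocycle⇒identity cocycle T σ₁ σ₂

  module BasePoint (transitive : Transitive α) (x : X) where

    t : X → |G|
    t y = proj₁ (transitive x y)

    t-spec : ∀ y → act (t y) x ≡ y
    t-spec y = proj₂ (transitive x y)

    act-t⁻¹ : ∀ y → act (t y ⁻¹) y ≡ x
    act-t⁻¹ y = trans (cong (act (t y ⁻¹)) (sym (t-spec y))) (act-inverseˡ (t y) x)

    σ : |G| → X → |G|
    σ g y = t y ⁻¹ ∙ (g ∙ t (act (g ⁻¹) y))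

    σ-spec : ∀ g y → g ∙ t (act (g ⁻¹) y) ≡ t y ∙ σ g y
    σ-spec g y = sym (GP.\\-leftDividesˡ (t y) _)

    σ-Stab : ∀ g y → Stab x (σ g y)
    σ-Stab g y = begin
      act (t y ⁻¹ ∙ (g ∙ t u)) x          ≡⟨ act-∙ _ _ x ⟩
      act (t y ⁻¹) (act (g ∙ t u) x)      ≡⟨ cong (act (t y ⁻¹)) (act-∙ g (t u) x) ⟩
      act (t y ⁻¹) (act g (act (t u) x))  ≡⟨ cong (λ z → act (t y ⁻¹) (act g z)) (t-spec u) ⟩
      act (t y ⁻¹) (act g u)              ≡⟨ cong (act (t y ⁻¹)) (act-inverseʳ g y) ⟩
      act (t y ⁻¹) y                      ≡⟨ act-t⁻¹ y ⟩
      x                                   ∎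
      where u = act (g ⁻¹) y

    σ-∙ : ∀ g h y → σ (g ∙ h) y ≡ σ g y ∙ σ h (act (g ⁻¹) y)
    σ-∙ g h y = GP.∙-cancelˡ (t y) _ _ (begin
      t y ∙ σ (g ∙ h) y                      ≡⟨ σ-spec (g ∙ h) y ⟨
      (g ∙ h) ∙ t (act ((g ∙ h) ⁻¹) y)       ≡⟨ cong (λ z → (g ∙ h) ∙ t z) (act-∙⁻¹ g h y) ⟩
      (g ∙ h) ∙ t (act (h ⁻¹) u)             ≡⟨ GS.assoc g h _ ⟩
      g ∙ (h ∙ t (act (h ⁻¹) u))             ≡⟨ cong (g ∙_) (σ-spec h u) ⟩
      g ∙ (t u ∙ σ h u)                      ≡⟨ GS.assoc g (t u) _ ⟨
      (g ∙ t u) ∙ σ h u                      ≡⟨ cong (_∙ σ h u) (σ-spec g y) ⟩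
      (t y ∙ σ g y) ∙ σ h u                  ≡⟨ GS.assoc (t y) _ _ ⟩
      t y ∙ (σ g y ∙ σ h u)                  ∎)
      where u = act (g ⁻¹) y

    crossedHom-principal : ∀ {d} → IsCrossedHom d → (∀ s → Stab x s → d s x ≡ 0#) →
      ∃[ φ ] ∀ g y → d g y ≡ φ y - φ (act (g ⁻¹) y)
    crossedHom-principal {d} cross vanish = φ , λ g y → begin
      d g y                                   ≡⟨ solve 2 (λ dg φu → dg ⊜ (dg :+ φu) :- φu) refl _ _ ⟩
      (d g y + φ (act (g ⁻¹) y)) - φ (act (g ⁻¹) y) ≡⟨ cong (_- φ (act (g ⁻¹) y)) (d-split g y) ⟩
      (φ y + 0#) - φ (act (g ⁻¹) y)           ≡⟨ cong (_- φ (act (g ⁻¹) y)) (AS.identityʳ (φ y)) ⟩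
      φ y - φ (act (g ⁻¹) y)                  ∎
      where
        φ : X → |A|
        φ y = d (t y) y
        d-split : ∀ g y → d g y + φ (act (g ⁻¹) y) ≡ φ y + 0#
        d-split g y = begin
          d g y + φ (act (g ⁻¹) y)                 ≡⟨ cross g _ y ⟨
          d (g ∙ t (act (g ⁻¹) y)) y               ≡⟨ cong (λ k → d k y) (σ-spec g y) ⟩
          d (t y ∙ σ g y) y                        ≡⟨ cross (t y) (σ g y) y ⟩
          φ y + d (σ g y) (act (t y ⁻¹) y)         ≡⟨ cong (λ z → φ y + d (σ g y) z) (act-t⁻¹ y) ⟩
          φ y + d (σ g y) x                        ≡⟨ cong (φ y +_) (vanish (σ g y) (σ-Stab g y)) ⟩
          φ y + 0#                                 ∎

    IsCrossedHom⇒HomOn : ∀ {d} → IsCrossedHom d → HomOn (Stab x)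
    IsCrossedHom⇒HomOn {d} cross = record
      { ψ   = λ g _ → d g x
      ; hom = λ g h gx≡x _ _ → trans (cross g h x) (cong (λ z → d g x + d h z) (Stab-⁻¹ gx≡x))
      }

    crossedHom-decompose : Res1Surj x → ∀ {d} → IsCrossedHom d →
      ∃[ χ ] ∃[ φ ] ∀ g y → d g y ≡ Hom.χ χ g + (φ y - φ (act (g ⁻¹) y))
    crossedHom-decompose r₁-surjective {d} cross with r₁-surjective (IsCrossedHom⇒HomOn cross)
    ... | χ , χ-extends with crossedHom-principal (IsCrossedHom-sub cross (Hom⇒IsCrossedHom χ))
                               (λ s sx≡x → trans (cong (λ z → d s x - z) (χ-extends s sx≡x)) (AS.inverseʳ (d s x)))
    ... | φ , d-χ≡ = χ , φ , λ g y → begin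
      d g y                                     ≡⟨ solve 2 (λ dg χg → dg ⊜ χg :+ (dg :- χg)) refl _ _ ⟩
      Hom.χ χ g + (d g y - Hom.χ χ g)           ≡⟨ cong (Hom.χ χ g +_) (d-χ≡ g y) ⟩
      Hom.χ χ g + (φ y - φ (act (g ⁻¹) y))      ∎

    -- The first two terms of F have coboundary c − c(σ₁, σ₂) (Cocycle-transfer); since σ takes
    -- values in G_x and is multiplicative along g, h (σ-∙), the b-term removes c(σ₁, σ₂).
    Cocycle∩InKerRes2⇒Trivialises : ∀ {c} → Cocycle c → InKerRes2 x c → ∃[ F ] Trivialises F c
    Cocycle∩InKerRes2⇒Trivialises {c} cocycle (b , c≡∂b) = F , F-trivialises
      where
        F : |G| → X → |A|
        F g y = (c g (t (act (g ⁻¹) y)) - c (t y) (σ g y)) + b (σ g y) (σ-Stab g y)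

        F-trivialises : Trivialises F c
        F-trivialises g h y = begin
          F g y + F h (act (g ⁻¹) y)
            ≡⟨ solve 6 (λ cgU cTσ₁ b₁ chW cUσ₂ b₂ →
                   ((cgU :- cTσ₁) :+ b₁) :+ ((chW :- cUσ₂) :+ b₂) ⊜ ((cgU :- cTσ₁) :+ (chW :- cUσ₂)) :+ (b₁ :+ b₂))
                 refl _ _ _ _ _ _ ⟩
          ((c g (t u) - c (t y) σ₁) + (c h W - c (t u) σ₂)) + (b σ₁ p₁ + b σ₂ p₂)
            ≡⟨ cong (_+ (b σ₁ p₁ + b σ₂ p₂)) (Cocycle-transfer cocycle (σ-spec g y) (σ-spec h u)) ⟩
          ((c g h - c σ₁ σ₂) + (c (g ∙ h) W - c (t y) (σ₁ ∙ σ₂))) + (b σ₁ p₁ + b σ₂ p₂)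
            ≡⟨ cong (λ z → ((c g h - z) + (c (g ∙ h) W - c (t y) (σ₁ ∙ σ₂))) + (b σ₁ p₁ + b σ₂ p₂)) (c≡∂b σ₁ σ₂ p₁ p₂ p₁₂) ⟩
          ((c g h - ((b σ₂ p₂ - b (σ₁ ∙ σ₂) p₁₂) + b σ₁ p₁)) + (c (g ∙ h) W - c (t y) (σ₁ ∙ σ₂))) + (b σ₁ p₁ + b σ₂ p₂)
            ≡⟨ solve 6 (λ cgh b₁ b₂ b₁₂ cghW cTσ₁₂ →
                   ((cgh :- ((b₂ :- b₁₂) :+ b₁)) :+ (cghW :- cTσ₁₂)) :+ (b₁ :+ b₂) ⊜ cgh :+ ((cghW :- cTσ₁₂) :+ b₁₂))
                 refl _ _ _ _ _ _ ⟩
          c g h + ((c (g ∙ h) W - c (t y) (σ₁ ∙ σ₂)) + b (σ₁ ∙ σ₂) p₁₂)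
            ≡⟨ cong (c g h +_) F-∙ ⟨
          c g h + F (g ∙ h) y ∎
          where
            u = act (g ⁻¹) y
            W = t (act (h ⁻¹) u)
            σ₁ = σ g y
            σ₂ = σ h u
            p₁ = σ-Stab g y
            p₂ = σ-Stab h u
            p₁₂ : Stab x (σ₁ ∙ σ₂)
            p₁₂ = subst (Stab x) (σ-∙ g h y) (σ-Stab (g ∙ h) y)
            F-∙ : F (g ∙ h) y ≡ (c (g ∙ h) W - c (t y) (σ₁ ∙ σ₂)) + b (σ₁ ∙ σ₂) p₁₂
            F-∙ = cong₂ _+_ (cong₂ _-_ (cong (λ z → c (g ∙ h) (t z)) (act-∙⁻¹ g h y)) (cong (c (t y)) (σ-∙ g h y)))
                            (dcong₂ b (σ-∙ g h y) refl)

    Conjugate-Gχ⇒agree : ∀ χ χ′ → Conjugate (Gχ χ) (Gχ χ′) → ∀ g → Stab x g → Hom.χ χ g ≡ Hom.χ χ′ g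
    Conjugate-Gχ⇒agree χ χ′ ((φ , k) , conj) g gx≡x with proj₁ (conj ((λ _ → Hom.χ χ g) , g)) (g , (λ _ → refl) , refl)
    ... | g′ , f≡ , kgk⁻¹≡g′ = begin
      Hom.χ χ g                                             ≡⟨ solve 2 (λ φy χg → χg ⊜ (φy :+ χg) :- φy) refl (φ y₀) _ ⟩
      (φ y₀ + Hom.χ χ g) - φ y₀                             ≡⟨ cong (λ z → (φ y₀ + Hom.χ χ g) - φ z) y₀-fixed ⟨
      (φ y₀ + Hom.χ χ g) - φ (act k (act ((k ∙ g) ⁻¹) y₀))  ≡⟨ f≡ y₀ ⟩
      Hom.χ χ′ g′                                           ≡⟨ cong (Hom.χ χ′) kgk⁻¹≡g′ ⟨
      Hom.χ χ′ ((k ∙ g) ∙ k ⁻¹)                             ≡⟨ Hom-conjugation-invariant χ′ k g ⟩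
      Hom.χ χ′ g                                            ∎
      where
        y₀ = act k x
        y₀-fixed : act k (act ((k ∙ g) ⁻¹) y₀) ≡ y₀
        y₀-fixed = cong (act k) (begin
          act ((k ∙ g) ⁻¹) (act k x)              ≡⟨ act-∙⁻¹ k g _ ⟩
          act (g ⁻¹) (act (k ⁻¹) (act k x))       ≡⟨ cong (act (g ⁻¹)) (act-inverseˡ k x) ⟩
          act (g ⁻¹) x                            ≡⟨ Stab-⁻¹ gx≡x ⟩
          x                                       ∎)

    agree⇒Conjugate-Gχ : ∀ χ χ′ → (∀ g → Stab x g → Hom.χ χ g ≡ Hom.χ χ′ g) → Conjugate (Gχ χ) (Gχ χ′)
    agree⇒Conjugate-Gχ χ χ′ agree with crossedHom-principal (IsCrossedHom-sub (Hom⇒IsCrossedHom χ′) (Hom⇒IsCrossedHom χ))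
                                         (λ s sx≡x → trans (cong (λ z → Hom.χ χ′ s - z) (agree s sx≡x)) (AS.inverseʳ _))
    ... | φ , χ′-χ≡ = Conjugate-resp (≐-sym (Gχ≐Graph χ)) (≐-sym (Gχ≐Graph χ′)) (graph-conjugate φ λ g y → begin
      Hom.χ χ′ g                                   ≡⟨ solve 2 (λ χ′g χg → χ′g ⊜ (χ′g :- χg) :+ χg) refl _ _ ⟩
      (Hom.χ χ′ g - Hom.χ χ g) + Hom.χ χ g         ≡⟨ cong (_+ Hom.χ χ g) (χ′-χ≡ g y) ⟩
      (φ y - φ (act (g ⁻¹) y)) + Hom.χ χ g         ≡⟨ solve 3 (λ φy φu χg → (φy :- φu) :+ χg ⊜ (φy :+ χg) :- φu) refl _ _ _ ⟩
      (φ y + Hom.χ χ g) - φ (act (g ⁻¹) y)         ∎)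

    ℭ⇒Conjugate-Gχ : Res1Surj x → ∀ C → Inℭ C → ∃[ χ ] Conjugate (Subgroup.S C) (Gχ χ)
    ℭ⇒Conjugate-Gχ r₁-surjective C inℭ@(surj , _) =
      χ , Conjugate-resp (≐-sym (graph-of-section {C = C} (Inℭ⇒KernelIs {C} inℭ) sec)) (≐-sym (Gχ≐Graph χ))
                         (graph-conjugate (λ y → - φ y) F′≡)
      where
        F = proj₁ (Surjπ⇒Section {C} surj)
        sec = proj₂ (Surjπ⇒Section {C} surj)
        decomposition = crossedHom-decompose r₁-surjective (Inℭ-Section⇒IsCrossedHom {C} {F} inℭ sec)
        χ = proj₁ decomposition
        φ = proj₁ (proj₂ decomposition)
        F≡ = proj₂ (proj₂ decomposition)
        F′≡ : ∀ g y → Hom.χ χ g ≡ (- φ y + F g y) - (- φ (act (g ⁻¹) y))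
        F′≡ g y = begin
          Hom.χ χ g                                                                 ≡⟨ solve 3 (λ χg φy φu → χg ⊜ ((:- φy) :+ (χg :+ (φy :- φu))) :- (:- φu)) refl _ _ _ ⟩
          (- φ y + (Hom.χ χ g + (φ y - φ (act (g ⁻¹) y)))) - (- φ (act (g ⁻¹) y))  ≡⟨ cong (λ z → (- φ y + z) - (- φ (act (g ⁻¹) y))) (F≡ g y) ⟨
          (- φ y + F g y) - (- φ (act (g ⁻¹) y))                                    ∎

    𝔊-cohomologous⇒Conjugate : Res1Surj x → (C₁ C₂ : Subgroup) → In𝔊 C₁ → In𝔊 C₂ → (c₁ c₂ : Cochain2)
      → Represents C₁ c₁ → Represents C₂ c₂ → Cohomologous c₁ c₂ → Conjugate (Subgroup.S C₁) (Subgroup.S C₂)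
    𝔊-cohomologous⇒Conjugate r₁-surjective C₁ C₂ in𝔊₁ in𝔊₂ c₁ c₂ R₁ R₂ (b , coh) =
      Conjugate-resp (≐-sym (graph-of-section {C = C₁} (In𝔊⇒KernelIs {C₁} in𝔊₁) sec₁))
                     (≐-trans (graph-shift e F₂) (≐-sym (graph-of-section {C = C₂} (In𝔊⇒KernelIs {C₂} in𝔊₂) sec₂)))
                     (graph-conjugate (λ y → - φ y) F′≡)
      where
        F₁ = proj₁ (Represents⇒Section C₁ c₁ R₁)
        sec₁ = proj₁ (proj₂ (Represents⇒Section C₁ c₁ R₁))
        F₂ = proj₁ (Represents⇒Section C₂ c₂ R₂)
        sec₂ = proj₁ (proj₂ (Represents⇒Section C₂ c₂ R₂))
        decomposition = crossedHom-decompose r₁-surjective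
          (Trivialises-cohomologous (proj₂ (proj₂ (Represents⇒Section C₁ c₁ R₁))) (proj₂ (proj₂ (Represents⇒Section C₂ c₂ R₂))) b coh)
        χ = proj₁ decomposition
        φ = proj₁ (proj₂ decomposition)
        D≡ = proj₂ (proj₂ decomposition)
        e : |G| → |A|
        e g = b g + Hom.χ χ g
        F′≡ : ∀ g y → e g + F₂ g y ≡ (- φ y + F₁ g y) - (- φ (act (g ⁻¹) y))
        F′≡ g y = begin
          e g + F₂ g y
            ≡⟨ solve 5 (λ bg χg F₂g φy φu → (bg :+ χg) :+ F₂g ⊜ ((:- φy) :+ ((χg :+ (φy :- φu)) :+ (F₂g :+ bg))) :- (:- φu)) refl _ _ _ _ _ ⟩
          (- φ y + ((Hom.χ χ g + (φ y - φ (act (g ⁻¹) y))) + (F₂ g y + b g))) - (- φ (act (g ⁻¹) y))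
            ≡⟨ cong (λ z → (- φ y + (z + (F₂ g y + b g))) - (- φ (act (g ⁻¹) y))) (D≡ g y) ⟨
          (- φ y + (((F₁ g y - F₂ g y) - b g) + (F₂ g y + b g))) - (- φ (act (g ⁻¹) y))
            ≡⟨ solve 5 (λ φy F₁g F₂g bg φu → ((:- φy) :+ (((F₁g :- F₂g) :- bg) :+ (F₂g :+ bg))) :- (:- φu) ⊜ ((:- φy) :+ F₁g) :- (:- φu)) refl _ _ _ _ _ ⟩
          (- φ y + F₁ g y) - (- φ (act (g ⁻¹) y))
            ∎

    𝔊⇒Represents∩InKerRes2 : (C : Subgroup) → In𝔊 C
      → (∃[ c ] Represents C c) × ((c : Cochain2) → Represents C c → InKerRes2 x c)
    𝔊⇒Represents∩InKerRes2 C in𝔊 =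
      In𝔊⇒Represents {C} in𝔊 , λ c R → Trivialises⇒InKerRes2 x (proj₂ (proj₂ (Represents⇒Section C c R)))

    InKerRes2⇒𝔊 : (c : Cochain2) → Cocycle c → InKerRes2 x c
      → ∃[ C ] (In𝔊 C × ∃[ c′ ] (Represents C c′ × Cohomologous c′ c))
    InKerRes2⇒𝔊 c cocycle c∈ker = subgroup , subgroup-In𝔊 , c , subgroup-Represents , Cohomologous-refl c
      where open GraphSubgroup (proj₂ (Cocycle∩InKerRes2⇒Trivialises cocycle c∈ker))

proposition2p3 : (G : ≡Group) (A : ≡AbGroup) (X : Set) (α : Action G X) → Transitive α → (x : X)
    → let open Setup G A X α in
      ((χ χ' : Hom) → Conjugate (Gχ χ) (Gχ χ') ⇔ (∀ g → Stab x g → Hom.χ χ g ≡ Hom.χ χ' g))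
      × (Res1Surj x → (C : Subgroup) → Inℭ C → ∃[ χ ] Conjugate (Subgroup.S C) (Gχ χ))
      × (Res1Surj x
         → ((C₁ C₂ : Subgroup) → In𝔊 C₁ → In𝔊 C₂ → (c₁ c₂ : Cochain2)
              → Represents C₁ c₁ → Represents C₂ c₂ → Cohomologous c₁ c₂
              → Conjugate (Subgroup.S C₁) (Subgroup.S C₂))
         × ((C : Subgroup) → In𝔊 C
              → (∃[ c ] Represents C c) × ((c : Cochain2) → Represents C c → InKerRes2 x c))
         × ((c : Cochain2) → Cocycle c → InKerRes2 x c
              → ∃[ C ] (In𝔊 C × ∃[ c' ] (Represents C c' × Cohomologous c' c))))
proposition2p3 G A X α transitive x =
    (λ χ χ′ → mk⇔ (Conjugate-Gχ⇒agree χ χ′) (agree⇒Conjugate-Gχ χ χ′))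
  , ℭ⇒Conjugate-Gχ
  , λ r₁-surjective → 𝔊-cohomologous⇒Conjugate r₁-surjective , 𝔊⇒Represents∩InKerRes2 , InKerRes2⇒𝔊
  where open SemidirectProduct G A X α
        open BasePoint transitive x
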